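{- Let $\mathcal{A}$ be a finite set and let $U=(u_1,u_2,u_3,\ldots)$ be an infinite sequence of elements of $\mathcal{A}$, with complexity function $\rho(n)$. Assume that $\liminf_{n\to\infty}\rho(n)/n<\infty$. Then $U$ has long repetitions.
   Context: For a positive integer $n$, the complexity $\rho(n)=\rho_U(n)$ is the number of distinct words of length $n$ occurring as $n$ consecutive terms of $U$, i.e. $\rho(n)=\bigl|\{u_ku_{k+1}\cdots u_{k+n-1} : k=1,2,3,\ldots\}\bigr|$. The word $u_1u_2\cdots u_N$ is said to have two disjoint equal subwords of length $\ell$ if there exist $k,n$ with $k+\ell\le n\le N+1-\ell$ and $u_k=u_n,\ u_{k+1}=u_{n+1},\ \ldots,\ u_{k+\ell-1}=u_{n+\ell-1}$. The sequence $U$ has long repetitions if there exist a real $\varepsilon>0$ and infinitely many natural numbers $N$ such that the word $u_1u_2\cdots u_N$ has two disjoint equal subwords of length exceeding $\varepsilon N$. -}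

module Defs where

open import Data.Nat using (ℕ; _+_; _*_; _≤_; _<_; _≥_)
open import Data.Fin using (Fin; toℕ)
open import Data.Vec using (Vec; tabulate)
open import Data.List using (List; length)
open import Data.List.Relation.Unary.All using (All)
open import Data.List.Relation.Unary.Unique.Propositional using (Unique)
open import Data.List.Membership.Propositional using (_∈_)
open import Data.Product using (Σ; ∃; _×_)
open import Relation.Binary.PropositionalEquality using (_≡_)

-- A sequence U = (u_1, u_2, ...) is modelled as u : ℕ → A with u 0 = u_1.

factor : {A : Set} → (ℕ → A) → (k n : ℕ) → Vec A n
factor u k n = tabulate (λ i → u (k + toℕ i))

-- ρ_U(n) = r : the set {factor u k n : k ∈ ℕ} has exactly r elements,
-- i.e. it is enumerated by a duplicate-free list of length r.
Complexity : {A : Set} → (ℕ → A) → (n r : ℕ) → Set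
Complexity {A} u n r =
  Σ (List (Vec A n)) λ L →
    (length L ≡ r)
    × Unique L
    × All (λ w → ∃ λ k → factor u k n ≡ w) L
    × (∀ k → factor u k n ∈ L)

-- liminf_{n→∞} ρ(n)/n < ∞ : there is a constant C such that
-- ρ(n) ≤ C·n for infinitely many n.
LiminfComplexityFinite : {A : Set} → (ℕ → A) → Set
LiminfComplexityFinite u =
  ∃ λ C → ∀ m → ∃ λ n → n ≥ m × ∃ λ r → Complexity u n r × r ≤ C * n

-- The word u_1 ... u_N has two disjoint equal subwords of length ℓ:
-- 1-based positions k, n with k + ℓ ≤ n ≤ N + 1 - ℓ; here with 0-based
-- positions k' = k - 1, n' = n - 1: k' + ℓ ≤ n' and n' + ℓ ≤ N.
TwoDisjointEqualSubwords : {A : Set} → (ℕ → A) → (N ℓ : ℕ) → Set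
TwoDisjointEqualSubwords u N ℓ =
  ∃ λ k → ∃ λ n → (k + ℓ ≤ n) × (n + ℓ ≤ N) × (factor u k ℓ ≡ factor u n ℓ)

-- Long repetitions: a rational ε = p / q > 0 and infinitely many N such that
-- u_1 ... u_N has two disjoint equal subwords of some length ℓ > ε N
-- (i.e. q · ℓ > p · N).
LongRepetitions : {A : Set} → (ℕ → A) → Set
LongRepetitions u =
  ∃ λ p → ∃ λ q → (0 < p) × (0 < q) ×
    (∀ M → ∃ λ N → N ≥ M × ∃ λ ℓ → (p * N < q * ℓ) × TwoDisjointEqualSubwords u N ℓ)

-- If ρ(n) ≤ C n then among the ρ(n) + 1 factors of length n starting at
-- positions 0, …, ρ(n) two coincide, say at a and a + d with 0 < d ≤ C n.
-- Then u has period d on the window [a, a + d + n), so the prefix of length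
-- N = a + d + n ≤ (C + 1) n contains two disjoint copies of any word of
-- length ⌊n/2⌋ read inside that window. Taking n large gives ⌊n/2⌋ > N / (2C + 4).
module Submission where

open import Defs
open import Data.Nat using (ℕ; zero; suc; _+_; _*_; _∸_; _≤_; _<_; _≥_; z<s; s≤s⁻¹; NonZero; >-nonZero; ⌊_/2⌋; ⌈_/2⌉)
open import Data.Nat.Properties
open import Data.Nat.DivMod using (_/_; _%_; m≡m%n+[m/n]*n; m%n<n; m/n*n≤m)
open import Data.Nat.Tactic.RingSolver using (solve-∀)
open import Data.Fin using (Fin; toℕ; fromℕ<)
open import Data.Fin.Properties using (pigeonhole; toℕ<n; toℕ-fromℕ<)
open import Data.Vec using (lookup)
open import Data.Vec.Properties using (lookup∘tabulate; tabulate-cong)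
import Data.List as List
open import Data.List.Relation.Unary.Any using (index)
open import Data.List.Relation.Unary.Any.Properties using (lookup-index)
open import Data.Product using (∃; ∃₂; _×_; _,_)
open import Function.Bundles using (_↔_)
open import Relation.Binary.PropositionalEquality using (_≡_; refl; sym; trans; cong; subst₂; module ≡-Reasoning)

⌊n/2⌋+⌊n/2⌋≤n : ∀ n → ⌊ n /2⌋ + ⌊ n /2⌋ ≤ n
⌊n/2⌋+⌊n/2⌋≤n n = ≤-trans (+-monoʳ-≤ ⌊ n /2⌋ (⌊n/2⌋≤⌈n/2⌉ n)) (≤-reflexive (⌊n/2⌋+⌈n/2⌉≡n n))

n≤1+⌊n/2⌋+⌊n/2⌋ : ∀ n → n ≤ suc (⌊ n /2⌋ + ⌊ n /2⌋)
n≤1+⌊n/2⌋+⌊n/2⌋ n = begin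
  n                        ≡⟨ ⌊n/2⌋+⌈n/2⌉≡n n ⟨
  ⌊ n /2⌋ + ⌈ n /2⌉        ≤⟨ +-monoʳ-≤ ⌊ n /2⌋ (⌊n/2⌋-mono (n≤1+n (suc n))) ⟩
  ⌊ n /2⌋ + suc ⌊ n /2⌋    ≡⟨ +-suc ⌊ n /2⌋ ⌊ n /2⌋ ⟩
  suc (⌊ n /2⌋ + ⌊ n /2⌋)  ∎
  where open ≤-Reasoning

multiple-between : ∀ h d .{{_ : NonZero d}} → ∃ λ m → h ≤ m * d × m * d ≤ d + h
multiple-between h d = suc (h / d) , h≤ , +-monoʳ-≤ d (m/n*n≤m h d)
  where
  h≤ : h ≤ d + (h / d) * d
  h≤ = begin
    h                    ≡⟨ m≡m%n+[m/n]*n h d ⟩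
    h % d + (h / d) * d  ≤⟨ +-monoˡ-≤ ((h / d) * d) (<⇒≤ (m%n<n h d)) ⟩
    d + (h / d) * d      ∎
    where open ≤-Reasoning

factor-≡⇒≡ : {A : Set} (u : ℕ → A) {k k′ n : ℕ} → factor u k n ≡ factor u k′ n →
             ∀ t → t < n → u (k + t) ≡ u (k′ + t)
factor-≡⇒≡ u {k} {k′} {n} eq t t<n = begin
  u (k + t)                   ≡⟨ cong (λ s → u (k + s)) (toℕ-fromℕ< t<n) ⟨
  u (k + toℕ i)               ≡⟨ lookup∘tabulate _ i ⟨
  lookup (factor u k n) i     ≡⟨ cong (λ w → lookup w i) eq ⟩
  lookup (factor u k′ n) i    ≡⟨ lookup∘tabulate _ i ⟩
  u (k′ + toℕ i)              ≡⟨ cong (λ s → u (k′ + s)) (toℕ-fromℕ< t<n) ⟩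
  u (k′ + t)                  ∎
  where
  i = fromℕ< t<n
  open ≡-Reasoning

period-shift : {A : Set} (u : ℕ → A) {a d n : ℕ} →
               (∀ t → t < n → u (a + t) ≡ u (a + d + t)) →
               ∀ m t → m * d + t < d + n → u (a + t) ≡ u (a + (m * d + t))
period-shift u             period zero    t _  = refl
period-shift u {a} {d} {n} period (suc m) t lt = begin
  u (a + t)                  ≡⟨ period-shift u period m t (≤-trans md+t<n (m≤n+m n d)) ⟩
  u (a + (m * d + t))        ≡⟨ period (m * d + t) md+t<n ⟩
  u (a + d + (m * d + t))    ≡⟨ cong u (trans (+-assoc a d _) (cong (a +_) (sym (+-assoc d (m * d) t)))) ⟩
  u (a + (d + m * d + t))    ∎
  where
  open ≡-Reasoning
  md+t<n : m * d + t < n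
  md+t<n = +-cancelˡ-< d (m * d + t) n (subst₂ _<_ (+-assoc d (m * d) t) refl lt)

equal-factors⇒disjoint-equal-subwords :
  {A : Set} (u : ℕ → A) {a d n ℓ : ℕ} → 0 < d → factor u a n ≡ factor u (a + d) n →
  ℓ + ℓ ≤ n → TwoDisjointEqualSubwords u (a + d + n) ℓ
equal-factors⇒disjoint-equal-subwords u {a} {d} {n} {ℓ} 0<d eq 2ℓ≤n
  with m , ℓ≤md , md≤d+ℓ ← multiple-between ℓ d {{>-nonZero 0<d}} =
  a , a + m * d , +-monoʳ-≤ a ℓ≤md , end-inside ,
  tabulate-cong λ i → trans (period-shift u (factor-≡⇒≡ u eq) m (toℕ i) (shift-inside i))
                            (cong u (sym (+-assoc a (m * d) (toℕ i))))
  where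
  open ≤-Reasoning
  end-inside : a + m * d + ℓ ≤ a + d + n
  end-inside = begin
    a + m * d + ℓ        ≤⟨ +-monoˡ-≤ ℓ (+-monoʳ-≤ a md≤d+ℓ) ⟩
    a + (d + ℓ) + ℓ      ≡⟨ cong (_+ ℓ) (+-assoc a d ℓ) ⟨
    a + d + ℓ + ℓ        ≡⟨ +-assoc (a + d) ℓ ℓ ⟩
    a + d + (ℓ + ℓ)      ≤⟨ +-monoʳ-≤ (a + d) 2ℓ≤n ⟩
    a + d + n            ∎
  shift-inside : (i : Fin ℓ) → m * d + toℕ i < d + n
  shift-inside i = begin-strict
    m * d + toℕ i        <⟨ +-monoʳ-< (m * d) (toℕ<n i) ⟩
    m * d + ℓ            ≤⟨ +-monoˡ-≤ ℓ md≤d+ℓ ⟩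
    d + ℓ + ℓ            ≡⟨ +-assoc d ℓ ℓ ⟩
    d + (ℓ + ℓ)          ≤⟨ +-monoʳ-≤ d 2ℓ≤n ⟩
    d + n                ∎

repeated-factor : {A : Set} (u : ℕ → A) {n r : ℕ} → Complexity u n r →
                  ∃₂ λ a d → 0 < d × a + d ≤ r × factor u a n ≡ factor u (a + d) n
repeated-factor u {n} (L , refl , _ , _ , covers)
  with i , j , i<j , same-index ← pigeonhole ≤-refl (λ (k : Fin (suc (List.length L))) → index (covers (toℕ k))) =
  toℕ i , toℕ j ∸ toℕ i , m<n⇒0<n∸m i<j ,
  subst₂ _≤_ (sym i+d≡j) refl (s≤s⁻¹ (toℕ<n j)) ,
  subst₂ _≡_ refl (cong (λ k → factor u k n) (sym i+d≡j)) same-factor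
  where
  i+d≡j : toℕ i + (toℕ j ∸ toℕ i) ≡ toℕ j
  i+d≡j = m+[n∸m]≡n (<⇒≤ i<j)
  same-factor : factor u (toℕ i) n ≡ factor u (toℕ j) n
  same-factor = trans (lookup-index (covers (toℕ i)))
                      (trans (cong (List.lookup L) same-index) (sym (lookup-index (covers (toℕ j)))))

prefix-ratio : ∀ C n ℓ N → N ≤ C * n + n → C + 3 ≤ n → n ≤ suc (ℓ + ℓ) → 1 * N < (4 + 2 * C) * ℓ
prefix-ratio C n ℓ N N≤ C+3≤n n≤ = subst₂ _<_ (sym (*-identityˡ N)) (2ℓ-scaled C ℓ)
  (+-cancelʳ-< (C + 2) N _ (begin-strict
    N + (C + 2)                  ≤⟨ +-monoˡ-≤ (C + 2) N≤ ⟩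
    C * n + n + (C + 2)          <⟨ +-monoʳ-< (C * n + n) (subst₂ _≤_ (+-suc C 2) refl C+3≤n) ⟩
    C * n + n + n                ≡⟨ collect C n ⟩
    (C + 2) * n                  ≤⟨ *-monoʳ-≤ (C + 2) n≤ ⟩
    (C + 2) * suc (ℓ + ℓ)        ≡⟨ *-suc (C + 2) (ℓ + ℓ) ⟩
    C + 2 + (C + 2) * (ℓ + ℓ)    ≡⟨ +-comm (C + 2) _ ⟩
    (C + 2) * (ℓ + ℓ) + (C + 2)  ∎))
  where
  open ≤-Reasoning
  collect : ∀ C n → C * n + n + n ≡ (C + 2) * n
  collect = solve-∀
  2ℓ-scaled : ∀ C ℓ → (C + 2) * (ℓ + ℓ) ≡ (4 + 2 * C) * ℓ
  2ℓ-scaled = solve-∀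

lemma3p4 : (A : Set) (a : ℕ) → A ↔ Fin a → (u : ℕ → A) →
    LiminfComplexityFinite u → LongRepetitions u
lemma3p4 _ _ _ u (C , ρ≤Cn-often) = 1 , 4 + 2 * C , z<s , z<s , long
  where
  long : ∀ M → ∃ λ N → N ≥ M × ∃ λ ℓ → 1 * N < (4 + 2 * C) * ℓ × TwoDisjointEqualSubwords u N ℓ
  long M with n , n≥ , r , ρn , r≤Cn ← ρ≤Cn-often (M + (C + 3))
         with a , d , 0<d , a+d≤r , eq ← repeated-factor u ρn =
    a + d + n , ≤-trans (≤-trans (m≤m+n M _) n≥) (m≤n+m n (a + d)) , ⌊ n /2⌋ ,
    prefix-ratio C n ⌊ n /2⌋ (a + d + n) (+-monoˡ-≤ n (≤-trans a+d≤r r≤Cn))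
                 (≤-trans (m≤n+m (C + 3) M) n≥) (n≤1+⌊n/2⌋+⌊n/2⌋ n) ,
    equal-factors⇒disjoint-equal-subwords u 0<d eq (⌊n/2⌋+⌊n/2⌋≤n n)
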